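{- For all integers $p\geq 2$ and $m\geq 2$, $D(C(m,p))>m$.
   Context: For integers $m\geq 1$, $p\geq 2$ with $n=mp\geq 3$, $C(m,p)$ is the graph with vertex set $\{0,1,\dots,n-1\}$ in which $i$ and $j$ are adjacent iff $j-i \bmod n$ belongs to $A=\{p-1+rp,\ p+1+rp : 0\leq r\leq m-1\}\subset\mathbb{Z}_n$. For a graph $G$, an $r$-labeling $c:V(G)\to\{1,\dots,r\}$ is $r$-distinguishing if for every automorphism $\sigma\neq \mathrm{id}$ of $G$ we have $c\neq c\circ\sigma$; the distinguishing number $D(G)$ is the smallest $r$ such that $G$ has an $r$-distinguishing labeling. -}

module Defs where

open import Data.Nat using (ℕ; _*_; _+_; _∸_; _<_)
open import Data.Integer as ℤ using (ℤ; +_)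
open import Data.Integer.Divisibility using (_∣_)
open import Data.Fin using (Fin; toℕ)
open import Data.Product using (Σ; _×_)
open import Data.Sum using (_⊎_)
open import Relation.Binary.PropositionalEquality using (_≡_)
open import Relation.Nullary using (¬_)

CongMod : ℕ → ℤ → ℤ → Set
CongMod n x y = (+ n) ∣ (x ℤ.- y)

CAdj : (m p : ℕ) → Fin (m * p) → Fin (m * p) → Set
CAdj m p i j =
  Σ ℕ λ r → (r < m) ×
    (CongMod (m * p) ((+ toℕ j) ℤ.- (+ toℕ i)) (+ ((p ∸ 1) + r * p))
     ⊎ CongMod (m * p) ((+ toℕ j) ℤ.- (+ toℕ i)) (+ ((p + 1) + r * p)))

record IsAutomorphism {n : ℕ} (Adj : Fin n → Fin n → Set) (σ : Fin n → Fin n) : Set where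
  field
    inv      : Fin n → Fin n
    inv-left  : ∀ v → inv (σ v) ≡ v
    inv-right : ∀ v → σ (inv v) ≡ v
    preserves : ∀ u v → Adj u v → Adj (σ u) (σ v)
    reflects  : ∀ u v → Adj (σ u) (σ v) → Adj u v

IsDistinguishing : {n r : ℕ} (Adj : Fin n → Fin n → Set) → (Fin n → Fin r) → Set
IsDistinguishing {n} Adj c =
  (σ : Fin n → Fin n) → IsAutomorphism Adj σ →
  ¬ (∀ v → σ v ≡ v) → ¬ (∀ v → c v ≡ c (σ v))

-- Adjacency in C(m,p) only depends on the residues mod p of the two vertices: u ~ v iff
-- v - u ≡ ±1 (mod p).  Hence every permutation that fixes all residues, or maps residue k to
-- -1 - k, is an automorphism.  Write vertex j·p + k as combine j k, so residue class k is a
-- copy of Fin m.  If a labelling with r ≤ m labels repeats inside some residue class, the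
-- transposition of the two equally labelled vertices is a nontrivial label-preserving
-- automorphism.  Otherwise every class is labelled bijectively, and sending each vertex of
-- class k to the equally labelled vertex of class -1 - k is one; it moves the vertices of
-- class 0 as p ≥ 2.
module Submission where

open import Defs
open import Data.Nat using (ℕ; _≤_; _*_)
open import Data.Fin using (Fin)
open import Relation.Nullary using (¬_)

open import Data.Nat as ℕ using (NonZero; _<_; _∸_; >-nonZero⁻¹; s≤s)
import Data.Nat.Properties as ℕ
open import Data.Integer as ℤ using (ℤ; +_; _+_; _-_; -_; 1ℤ; -1ℤ)
import Data.Integer.Properties as ℤ
open import Data.Integer.Divisibility.Signed
  using (_∣_; divides; ∣ᵤ⇒∣; ∣⇒∣ᵤ; ∣-refl; ∣-trans; ∣m∣n⇒∣m+n; ∣m⇒∣-m)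
open import Data.Integer.DivMod using (_%ℕ_; _/ℕ_; a≡a%ℕn+[a/ℕn]*n; n%ℕd<d)
open import Data.Integer.Tactic.RingSolver using (solve-∀)
open import Data.Fin as Fin using (toℕ; combine; remQuot; opposite; punchOut; _≟_)
import Data.Fin.Properties as Fin
open import Data.Fin.Permutation.Components using (transpose; transpose-inverse)
open import Data.Product as Product using (∃; ∃₂; _×_; _,_; proj₁; proj₂; uncurry)
open import Data.Sum as Sum using (_⊎_; inj₁; inj₂)
open import Data.Empty using (⊥-elim)
open import Function using (_∘_)
open import Function.Definitions using (Injective)
open import Relation.Binary.Core using (Rel)
open import Relation.Binary.Definitions using (Reflexive; Symmetric)
open import Relation.Binary.PropositionalEquality
open import Relation.Nullary using (Dec; yes; no; ¬?)
open import Relation.Nullary.Decidable using (_×-dec_; dec-true; decidable-stable)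

-- A record rather than a synonym for + n ∣ x - y, so that x, y and n can be inferred.
infix 4 _≡_mod_
record _≡_mod_ (x y : ℤ) (n : ℕ) : Set where
  constructor mod-by
  field divides-difference : + n ∣ x - y

module _ {n : ℕ} where

  ≡⇒≡-mod : ∀ {x y} → x ≡ y → x ≡ y mod n
  ≡⇒≡-mod {x} refl = mod-by (divides (+ 0) (trans (ℤ.+-inverseʳ x) (sym (ℤ.*-zeroˡ (+ n)))))

  ≡-mod-sym : ∀ {x y} → x ≡ y mod n → y ≡ x mod n
  ≡-mod-sym {x} {y} (mod-by x≡y) = mod-by (subst (+ n ∣_) (negate x y) (∣m⇒∣-m x≡y))
    where
    negate : ∀ x y → - (x - y) ≡ y - x
    negate = solve-∀

  ≡-mod-trans : ∀ {x y z} → x ≡ y mod n → y ≡ z mod n → x ≡ z mod n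
  ≡-mod-trans {x} {y} {z} (mod-by x≡y) (mod-by y≡z) =
    mod-by (subst (+ n ∣_) (telescope x y z) (∣m∣n⇒∣m+n x≡y y≡z))
    where
    telescope : ∀ x y z → (x - y) + (y - z) ≡ x - z
    telescope = solve-∀

  +-cong-mod : ∀ {a b c d} → a ≡ b mod n → c ≡ d mod n → a + c ≡ b + d mod n
  +-cong-mod {a} {b} {c} {d} (mod-by a≡b) (mod-by c≡d) =
    mod-by (subst (+ n ∣_) (regroup a b c d) (∣m∣n⇒∣m+n a≡b c≡d))
    where
    regroup : ∀ a b c d → (a - b) + (c - d) ≡ (a + c) - (b + d)
    regroup = solve-∀

  neg-cong-mod : ∀ {a b} → a ≡ b mod n → - a ≡ - b mod n
  neg-cong-mod {a} {b} (mod-by a≡b) = mod-by (subst (+ n ∣_) (negate a b) (∣m⇒∣-m a≡b))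
    where
    negate : ∀ a b → - (a - b) ≡ - a - - b
    negate = solve-∀

  -‿cong-mod : ∀ {a b c d} → a ≡ b mod n → c ≡ d mod n → a - c ≡ b - d mod n
  -‿cong-mod a≡b c≡d = +-cong-mod a≡b (neg-cong-mod c≡d)

pos-+-* : ∀ b r p → + (b ℕ.+ r * p) ≡ + b + + r ℤ.* + p
pos-+-* b r p = trans (ℤ.pos-+ b (r * p)) (cong (λ x → + b + x) (ℤ.pos-* r p))

+-multiple-mod : ∀ {p} b r → + (b ℕ.+ r * p) ≡ + b mod p
+-multiple-mod {p} b r = mod-by (divides (+ r) (begin
  + (b ℕ.+ r * p) - + b       ≡⟨ cong (_- + b) (pos-+-* b r p) ⟩
  + b + + r ℤ.* + p - + b     ≡⟨ cancel (+ b) (+ r) (+ p) ⟩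
  + r ℤ.* + p                 ∎))
  where
  open ≡-Reasoning
  cancel : ∀ b r p → b + r ℤ.* p - b ≡ r ℤ.* p
  cancel = solve-∀

CongMod⇒≡-mod : ∀ m {p x y} → CongMod (m * p) x y → x ≡ y mod p
CongMod⇒≡-mod m {p} x≡y = mod-by (∣-trans (divides (+ m) (ℤ.pos-* m p)) (∣ᵤ⇒∣ x≡y))

-- Write x - b = t p and t = r + s m with r = t mod m: then x - (b + r p) = s (m p).
≡-mod⇒CongMod : ∀ m {p} .{{_ : NonZero m}} {x b} → x ≡ + b mod p →
                 ∃ λ r → r < m × CongMod (m * p) x (+ (b ℕ.+ r * p))
≡-mod⇒CongMod m {p} {x} {b} (mod-by (divides t x-b≡tp)) =
  r , n%ℕd<d t m , ∣⇒∣ᵤ (divides s (begin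
  x - + (b ℕ.+ r * p)                         ≡⟨ cong (λ y → x - y) (pos-+-* b r p) ⟩
  x - (+ b + + r ℤ.* + p)                     ≡⟨ split x (+ b) (+ r) (+ p) ⟩
  (x - + b) - + r ℤ.* + p                     ≡⟨ cong (_- + r ℤ.* + p) x-b≡tp ⟩
  t ℤ.* + p - + r ℤ.* + p
    ≡⟨ cong (λ t → t ℤ.* + p - + r ℤ.* + p) (a≡a%ℕn+[a/ℕn]*n t m) ⟩
  (+ r + s ℤ.* + m) ℤ.* + p - + r ℤ.* + p     ≡⟨ cancel (+ r) s (+ m) (+ p) ⟩
  s ℤ.* (+ m ℤ.* + p)                         ≡⟨ cong (s ℤ.*_) (ℤ.pos-* m p) ⟨
  s ℤ.* + (m * p)                             ∎))
  where
  open ≡-Reasoning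
  r = t %ℕ m
  s = t /ℕ m
  split : ∀ x b r p → x - (b + r ℤ.* p) ≡ (x - b) - r ℤ.* p
  split = solve-∀
  cancel : ∀ r s m p → (r + s ℤ.* m) ℤ.* p - r ℤ.* p ≡ s ℤ.* (m ℤ.* p)
  cancel = solve-∀

⟦_⟧ : ∀ {n} → Fin n → ℤ
⟦ v ⟧ = + toℕ v

diff : ∀ {n} → Fin n → Fin n → ℤ
diff u v = ⟦ v ⟧ - ⟦ u ⟧

UnitStep : ℕ → ℤ → Set
UnitStep p d = d ≡ -1ℤ mod p ⊎ d ≡ 1ℤ mod p

UnitStep-resp : ∀ {p d d′} → d ≡ d′ mod p → UnitStep p d → UnitStep p d′
UnitStep-resp d≡d′ = Sum.map (≡-mod-trans (≡-mod-sym d≡d′)) (≡-mod-trans (≡-mod-sym d≡d′))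

UnitStep-neg : ∀ {p d} → UnitStep p d → UnitStep p (- d)
UnitStep-neg = Sum.swap ∘ Sum.map neg-cong-mod neg-cong-mod

p∸1≡-1-mod : ∀ p .{{_ : NonZero p}} → + (p ∸ 1) ≡ -1ℤ mod p
p∸1≡-1-mod p = mod-by (subst (+ p ∣_) (cong +_ (sym (ℕ.m∸n+n≡m (>-nonZero⁻¹ p)))) ∣-refl)

p+1≡1-mod : ∀ p → + (p ℕ.+ 1) ≡ 1ℤ mod p
p+1≡1-mod p = mod-by (divides 1ℤ (trans (cong (_- 1ℤ) (ℤ.pos-+ p 1)) (cancel (+ p))))
  where
  cancel : ∀ x → x + 1ℤ - 1ℤ ≡ 1ℤ ℤ.* x
  cancel = solve-∀

module _ (m p : ℕ) .{{_ : NonZero p}} (u v : Fin (m * p)) where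

  CAdj⇒UnitStep : CAdj m p u v → UnitStep p (diff u v)
  CAdj⇒UnitStep (r , _ , inj₁ d≡p∸1) =
    inj₁ (≡-mod-trans (≡-mod-trans (CongMod⇒≡-mod m d≡p∸1) (+-multiple-mod (p ∸ 1) r))
                      (p∸1≡-1-mod p))
  CAdj⇒UnitStep (r , _ , inj₂ d≡p+1) =
    inj₂ (≡-mod-trans (≡-mod-trans (CongMod⇒≡-mod m d≡p+1) (+-multiple-mod (p ℕ.+ 1) r))
                      (p+1≡1-mod p))

  UnitStep⇒CAdj : .{{_ : NonZero m}} → UnitStep p (diff u v) → CAdj m p u v
  UnitStep⇒CAdj (inj₁ d≡-1) =
    Product.map₂ (Product.map₂ inj₁)
      (≡-mod⇒CongMod m (≡-mod-trans d≡-1 (≡-mod-sym (p∸1≡-1-mod p))))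
  UnitStep⇒CAdj (inj₂ d≡1) =
    Product.map₂ (Product.map₂ inj₂)
      (≡-mod⇒CongMod m (≡-mod-trans d≡1 (≡-mod-sym (p+1≡1-mod p))))

PreservesAdj : ∀ {n} → Rel (Fin n) _ → (Fin n → Fin n) → Set
PreservesAdj Adj σ = ∀ u v → Adj u v → Adj (σ u) (σ v)

isAutomorphism : ∀ {n} {Adj : Rel (Fin n) _} (σ τ : Fin n → Fin n) →
                 (∀ v → τ (σ v) ≡ v) → (∀ v → σ (τ v) ≡ v) →
                 PreservesAdj Adj σ → PreservesAdj Adj τ → IsAutomorphism Adj σ
isAutomorphism {Adj = Adj} σ τ τσ≗id στ≗id σ-pres τ-pres = record
  { inv       = τ
  ; inv-left  = τσ≗id
  ; inv-right = στ≗id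
  ; preserves = σ-pres
  ; reflects  = λ u v adj → subst₂ Adj (τσ≗id u) (τσ≗id v) (τ-pres (σ u) (σ v) adj)
  }

module _ (m p : ℕ) .{{_ : NonZero m}} .{{_ : NonZero p}} {σ : Fin (m * p) → Fin (m * p)} where

  fixes-residues⇒preserves-CAdj : (∀ v → ⟦ v ⟧ ≡ ⟦ σ v ⟧ mod p) → PreservesAdj (CAdj m p) σ
  fixes-residues⇒preserves-CAdj fix u v =
    UnitStep⇒CAdj m p (σ u) (σ v) ∘ UnitStep-resp (-‿cong-mod (fix v) (fix u)) ∘ CAdj⇒UnitStep m p u v

  reflects-residues⇒preserves-CAdj : ∀ a → (∀ v → ⟦ σ v ⟧ + ⟦ v ⟧ ≡ a mod p) →
                                     PreservesAdj (CAdj m p) σ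
  reflects-residues⇒preserves-CAdj a reflect u v =
    UnitStep⇒CAdj m p (σ u) (σ v) ∘ UnitStep-resp (≡-mod-sym negated) ∘ UnitStep-neg ∘
    CAdj⇒UnitStep m p u v
    where
    regroup : ∀ σu σv u v → σv - σu ≡ ((σv + v) - (σu + u)) - (v - u)
    regroup = solve-∀
    cancel : ∀ a d → (a - a) - d ≡ - d
    cancel = solve-∀
    negated : diff (σ u) (σ v) ≡ - diff u v mod p
    negated = ≡-mod-trans (≡⇒≡-mod (regroup ⟦ σ u ⟧ ⟦ σ v ⟧ ⟦ u ⟧ ⟦ v ⟧))
      (≡-mod-trans (-‿cong-mod (-‿cong-mod (reflect v) (reflect u)) (≡⇒≡-mod refl))
                    (≡⇒≡-mod (cancel a (diff u v))))

combine-≡-mod : ∀ {m p} (j : Fin m) (k : Fin p) → ⟦ combine j k ⟧ ≡ ⟦ k ⟧ mod p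
combine-≡-mod {p = p} j k = mod-by (divides ⟦ j ⟧ (begin
  ⟦ combine j k ⟧ - ⟦ k ⟧           ≡⟨ cong (λ x → + x - ⟦ k ⟧) (Fin.toℕ-combine j k) ⟩
  + (p * toℕ j ℕ.+ toℕ k) - ⟦ k ⟧    ≡⟨ cong (_- ⟦ k ⟧) (ℤ.pos-+ (p * toℕ j) (toℕ k)) ⟩
  + (p * toℕ j) + ⟦ k ⟧ - ⟦ k ⟧      ≡⟨ cong (λ x → x + ⟦ k ⟧ - ⟦ k ⟧) (ℤ.pos-* p (toℕ j)) ⟩
  + p ℤ.* ⟦ j ⟧ + ⟦ k ⟧ - ⟦ k ⟧      ≡⟨ cancel (+ p) ⟦ j ⟧ ⟦ k ⟧ ⟩
  ⟦ j ⟧ ℤ.* + p                     ∎))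
  where
  open ≡-Reasoning
  cancel : ∀ p j k → p ℤ.* j + k - k ≡ j ℤ.* p
  cancel = solve-∀

opposite-+-≡-1-mod : ∀ {p} (k : Fin p) → ⟦ opposite k ⟧ + ⟦ k ⟧ ≡ -1ℤ mod p
opposite-+-≡-1-mod {p} k = mod-by (divides 1ℤ (begin
  ⟦ opposite k ⟧ + ⟦ k ⟧ - -1ℤ               ≡⟨ regroup ⟦ opposite k ⟧ ⟦ k ⟧ ⟩
  ⟦ opposite k ⟧ + + ℕ.suc (toℕ k)           ≡⟨ ℤ.pos-+ (toℕ (opposite k)) (ℕ.suc (toℕ k)) ⟨
  + (toℕ (opposite k) ℕ.+ ℕ.suc (toℕ k))     ≡⟨ cong +_ opposite+suc≡p ⟩
  + p                                        ≡⟨ ℤ.*-identityˡ (+ p) ⟨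
  1ℤ ℤ.* + p                                 ∎))
  where
  open ≡-Reasoning
  regroup : ∀ o k → o + k - -1ℤ ≡ o + (1ℤ + k)
  regroup = solve-∀
  opposite+suc≡p : toℕ (opposite k) ℕ.+ ℕ.suc (toℕ k) ≡ p
  opposite+suc≡p = trans (cong (ℕ._+ ℕ.suc (toℕ k)) (Fin.opposite-prop k)) (ℕ.m∸n+n≡m (Fin.toℕ<n k))

∀combine⇒∀ : ∀ m p {ℓ} {Q : Fin (m * p) → Set ℓ} → (∀ j k → Q (combine j k)) → ∀ v → Q v
∀combine⇒∀ m p {Q = Q} Q-combine v =
  subst Q (Fin.combine-remQuot {m} p v) (uncurry Q-combine (remQuot {m} p v))

transpose-related : ∀ {n ℓ} (R : Rel (Fin n) ℓ) → Reflexive R → Symmetric R →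
                    ∀ {a b} → R a b → ∀ v → R v (transpose a b v)
transpose-related R R-refl R-sym {a} {b} Rab v with v ≟ a
... | yes refl = Rab
... | no _ with v ≟ b
...   | yes refl = R-sym Rab
...   | no _ = R-refl

transpose-matchˡ : ∀ {n} (a b : Fin n) → transpose a b a ≡ b
transpose-matchˡ a b rewrite dec-true (a ≟ a) refl = refl

injective⇒surjective : ∀ {m r} {f : Fin m → Fin r} → r ≤ m → Injective _≡_ _≡_ f →
                       ∀ y → ∃ λ x → f x ≡ y
injective⇒surjective {r = ℕ.suc _} {f} r≤m f-inj y with Fin.any? (λ x → f x ≟ y)
... | yes hit = hit
... | no miss = ⊥-elim (Fin.<⇒notInjective r≤m punchOut-inj)
  where
  y≢f : ∀ x → y ≢ f x
  y≢f x y≡fx = miss (x , sym y≡fx)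
  punchOut-inj : Injective _≡_ _≡_ (λ x → punchOut (y≢f x))
  punchOut-inj {x} {x′} = f-inj ∘ Fin.punchOut-injective (y≢f x) (y≢f x′)

Collision : ∀ {m r} → (Fin m → Fin r) → Set
Collision f = ∃₂ λ i j → i ≢ j × f i ≡ f j

collision? : ∀ {m r} (f : Fin m → Fin r) → Dec (Collision f)
collision? f = Fin.any? λ i → Fin.any? λ j → ¬? (i ≟ j) ×-dec (f i ≟ f j)

¬collision⇒injective : ∀ {m r} {f : Fin m → Fin r} → ¬ Collision f → Injective _≡_ _≡_ f
¬collision⇒injective ¬collision {i} {j} fi≡fj =
  decidable-stable (i ≟ j) (λ i≢j → ¬collision (i , j , i≢j , fi≡fj))

module _ (m p : ℕ) .{{_ : NonZero m}} .{{_ : NonZero p}} {r : ℕ} (c : Fin (m * p) → Fin r) where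

  classColouring : Fin p → Fin m → Fin r
  classColouring k j = c (combine j k)

  collision⇒¬distinguishing : ∀ k → Collision (classColouring k) → ¬ IsDistinguishing (CAdj m p) c
  collision⇒¬distinguishing k (i , j , i≢j , same-colour) distinguishing =
    distinguishing (transpose a b) automorphism moves-a (transpose-related SameColour refl sym same-colour)
    where
    a b : Fin (m * p)
    a = combine i k
    b = combine j k
    SameColour SameResidue : Rel (Fin (m * p)) _
    SameColour u v = c u ≡ c v
    SameResidue u v = ⟦ u ⟧ ≡ ⟦ v ⟧ mod p
    a≡b-mod : SameResidue a b
    a≡b-mod = ≡-mod-trans (combine-≡-mod i k) (≡-mod-sym (combine-≡-mod j k))
    fixes : ∀ {x y} → SameResidue x y → PreservesAdj (CAdj m p) (transpose x y)
    fixes = fixes-residues⇒preserves-CAdj m p ∘ transpose-related SameResidue (≡⇒≡-mod refl) ≡-mod-sym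
    automorphism : IsAutomorphism (CAdj m p) (transpose a b)
    automorphism = isAutomorphism (transpose a b) (transpose b a)
      (λ _ → transpose-inverse b a) (λ _ → transpose-inverse a b)
      (fixes a≡b-mod) (fixes (≡-mod-sym a≡b-mod))
    moves-a : ¬ (∀ v → transpose a b v ≡ v)
    moves-a fixed = i≢j (Fin.combine-injectiveˡ i k j k (trans (sym (fixed a)) (transpose-matchˡ a b)))

  injective⇒¬distinguishing : 1 < p → r ≤ m → (∀ k → Injective _≡_ _≡_ (classColouring k)) →
                              ¬ IsDistinguishing (CAdj m p) c
  injective⇒¬distinguishing 1<p r≤m injective distinguishing =
    distinguishing σ automorphism moves-class-0 (∀combine⇒∀ m p (λ j k → sym (colour-σ j k)))
    where
    find : Fin p → Fin r → Fin m
    find k y = proj₁ (injective⇒surjective r≤m (injective k) y)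
    colour-find : ∀ k y → classColouring k (find k y) ≡ y
    colour-find k y = proj₂ (injective⇒surjective r≤m (injective k) y)
    find-colour : ∀ k j → find k (classColouring k j) ≡ j
    find-colour k j = injective k (colour-find k (classColouring k j))

    mirror : Fin m → Fin p → Fin (m * p)
    mirror j k = combine (find (opposite k) (classColouring k j)) (opposite k)
    σ : Fin (m * p) → Fin (m * p)
    σ v = uncurry mirror (remQuot p v)
    σ-combine : ∀ j k → σ (combine j k) ≡ mirror j k
    σ-combine j k = cong (uncurry mirror) (Fin.remQuot-combine j k)

    colour-σ : ∀ j k → c (σ (combine j k)) ≡ c (combine j k)
    colour-σ j k = trans (cong c (σ-combine j k)) (colour-find (opposite k) (classColouring k j))

    σ-involutive : ∀ v → σ (σ v) ≡ v
    σ-involutive = ∀combine⇒∀ m p λ j k →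
      let y = classColouring k j; k′ = opposite k; j′ = find k′ y in begin
      σ (σ (combine j k))                               ≡⟨ cong σ (σ-combine j k) ⟩
      σ (combine j′ k′)                                 ≡⟨ σ-combine j′ k′ ⟩
      combine (find (opposite k′) (classColouring k′ j′)) (opposite k′)
        ≡⟨ cong (λ y′ → combine (find (opposite k′) y′) (opposite k′)) (colour-find k′ y) ⟩
      combine (find (opposite k′) y) (opposite k′)      ≡⟨ cong (λ k″ → combine (find k″ y) k″) (Fin.opposite-involutive k) ⟩
      combine (find k y) k                              ≡⟨ cong (λ i → combine i k) (find-colour k j) ⟩
      combine j k                                       ∎
      where open ≡-Reasoning

    σ-reflects : ∀ v → ⟦ σ v ⟧ + ⟦ v ⟧ ≡ -1ℤ mod p
    σ-reflects = ∀combine⇒∀ m p λ j k →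
      subst (λ w → ⟦ w ⟧ + ⟦ combine j k ⟧ ≡ -1ℤ mod p) (sym (σ-combine j k))
        (≡-mod-trans (+-cong-mod (combine-≡-mod (find (opposite k) (classColouring k j)) (opposite k))
                                 (combine-≡-mod j k))
                     (opposite-+-≡-1-mod k))

    automorphism : IsAutomorphism (CAdj m p) σ
    automorphism = isAutomorphism σ σ σ-involutive σ-involutive pres pres
      where pres = reflects-residues⇒preserves-CAdj m p -1ℤ σ-reflects

    moves-class-0 : ¬ (∀ v → σ v ≡ v)
    moves-class-0 fixed = ℕ.<-irrefl (sym p∸1≡0) (ℕ.m<n⇒0<n∸m 1<p)
      where
      j₀ = Fin.fromℕ< (>-nonZero⁻¹ m)
      k₀ = Fin.fromℕ< (>-nonZero⁻¹ p)
      opposite-k₀≡k₀ : opposite k₀ ≡ k₀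
      opposite-k₀≡k₀ =
        Fin.combine-injectiveʳ _ _ j₀ k₀ (trans (sym (σ-combine j₀ k₀)) (fixed (combine j₀ k₀)))
      p∸1≡0 : p ∸ 1 ≡ 0
      p∸1≡0 = begin
        p ∸ 1                 ≡⟨ cong (λ i → p ∸ ℕ.suc i) (Fin.toℕ-fromℕ< (>-nonZero⁻¹ p)) ⟨
        p ∸ ℕ.suc (toℕ k₀)    ≡⟨ Fin.opposite-prop k₀ ⟨
        toℕ (opposite k₀)     ≡⟨ cong toℕ opposite-k₀≡k₀ ⟩
        toℕ k₀                ≡⟨ Fin.toℕ-fromℕ< (>-nonZero⁻¹ p) ⟩
        0                     ∎
        where open ≡-Reasoning

lemma2 : (m p : ℕ) → 2 ≤ p → 2 ≤ m →
    (r : ℕ) → 1 ≤ r → r ≤ m →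
    (c : Fin (m * p) → Fin r) → ¬ IsDistinguishing (CAdj m p) c
lemma2 m p 1<p@(s≤s _) (s≤s _) r _ r≤m c with Fin.any? (λ k → collision? (classColouring m p c k))
... | yes (k , collision) = collision⇒¬distinguishing m p c k collision
... | no ¬collision =
  injective⇒¬distinguishing m p c 1<p r≤m (λ k → ¬collision⇒injective (¬collision ∘ (k ,_)))
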